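{- Let $H$ be a finite cyclic group such that the oriented diameter of $Pow(H)$ is $2$, and let $p\neq 2$ be a prime with $\gcd(|H|,p)=1$. Then for every integer $\alpha\ge 1$, the oriented diameter of $Pow(H\times\mathbb{Z}_{p^{\alpha}})$ is $2$.
   Context: $\mathbb{Z}_m$ denotes the cyclic group of order $m$, and $H\times K$ the direct product. For a finite group $G$, the power graph $Pow(G)$ is the simple undirected graph with vertex set $G$ in which two distinct elements $x,y$ are adjacent if and only if one of them is an integer power of the other. An orientation of an undirected graph $X$ assigns exactly one direction to each edge of $X$. For a directed graph $D$, $d_D(u,v)$ is the length of a shortest directed path from $u$ to $v$ ($\infty$ if none exists), and $diam(D)=\max_{u,v} d_D(u,v)$. The oriented diameter $OD(X)$ of $X$ is the minimum of $diam(D)$ over all directed graphs $D$ obtained from $X$ by an orientation. -}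

module Defs where

open import Level using (0ℓ)
open import Data.Nat using (ℕ; zero; suc; _+_; _*_; _≤_)
open import Data.Fin using (Fin; toℕ)
open import Data.Product using (Σ; ∃; _×_; _,_)
open import Data.Sum using (_⊎_)
open import Relation.Nullary using (¬_)
open import Relation.Binary.PropositionalEquality using (_≡_)

record Graph (V : Set) : Set₁ where
  field
    Adj : V → V → Set

open Graph public

Digraph : Set → Set₁
Digraph V = V → V → Set

record IsOrientation {V : Set} (X : Graph V) (D : Digraph V) : Set where
  field
    arc⇒adj   : ∀ u v → D u v → Adj X u v
    adj⇒arc   : ∀ u v → Adj X u v → D u v ⊎ D v u
    not-both  : ∀ u v → D u v → ¬ D v u

data Walk {V : Set} (D : Digraph V) : V → V → ℕ → Set where
  here : ∀ {u} → Walk D u u zero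
  step : ∀ {u w v n} → D u w → Walk D w v n → Walk D u v (suc n)

DistLE : {V : Set} → Digraph V → V → V → ℕ → Set
DistLE D u v k = ∃ λ n → n ≤ k × Walk D u v n

DiamLE : {V : Set} → Digraph V → ℕ → Set
DiamLE {V} D k = ∀ (u v : V) → DistLE D u v k

OrientedDiameterIs : {V : Set} → Graph V → ℕ → Set₁
OrientedDiameterIs {V} X k =
  (Σ (Digraph V) λ D → IsOrientation X D × DiamLE D k)
  × (∀ (D : Digraph V) → IsOrientation X D → ∀ m → DiamLE D m → k ≤ m)

-- congruence modulo m (valid for every m)
_≡[_]_ : ℕ → ℕ → ℕ → Set
a ≡[ m ] b = ∃ λ s → ∃ λ t → a + s * m ≡ b + t * m

-- In ℤ_m: x = y^k (written additively, x = k·y)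
IsPowZ : (m : ℕ) → ℕ → Fin m → Fin m → Set
IsPowZ m k x y = toℕ x ≡[ m ] (k * toℕ y)

IsPowZ× : (m q : ℕ) → ℕ → Fin m × Fin q → Fin m × Fin q → Set
IsPowZ× m q k (x₁ , x₂) (y₁ , y₂) = IsPowZ m k x₁ y₁ × IsPowZ q k x₂ y₂

-- Power graph of a group given by its "x is the k-th power of y" relation:
-- distinct x,y adjacent iff one is an integer power of the other.
-- (In a finite group every integer power is a nonnegative power.)
PowGraph : {V : Set} → (ℕ → V → V → Set) → Graph V
PowGraph {V} pow = record
  { Adj = λ x y → ¬ (x ≡ y) × ((∃ λ k → pow k x y) ⊎ (∃ λ k → pow k y x)) }

PowZ : (m : ℕ) → Graph (Fin m)
PowZ m = PowGraph (IsPowZ m)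

PowZ× : (m q : ℕ) → Graph (Fin m × Fin q)
PowZ× m q = PowGraph (IsPowZ× m q)

module Submission where

-- Let q = p ^ α = 2k + 1 and let D orient Pow(ℤ_n) with diameter 2 (this forces n ≥ 3).
-- Orient Pow(ℤ_n × ℤ_q) as follows: inside each layer ℤ_n × {z} copy D; between layers follow
-- the rotational tournament z → z + d (1 ≤ d ≤ k) on ℤ_q, except that every arc at a "special"
-- vertex is reversed. For a unit c of ℤ_q the vertices (1, c) and (n − 1, c) generate the group,
-- so they are adjacent to everything, and exactly one of them is special. A tournament arc z → z′
-- lies on a 3-cycle z → z′ → c → z; unless z′ = z + 1 and p ∣ z + k + 1, the apex c can be taken
-- to be a unit, and the special (resp. non-special) vertex over c joins any (h, z) to (h′, z′)
-- by a path of length 2 whenever the direct edge points the wrong way. In the exceptional case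
-- the hubs over z and z + 1 are chosen so that a walk of D, together with the vertex (0, c) (adjacent
-- to every vertex whose ℤ_q-component is a unit), still gives a path of length at most 2.
-- Diameter 1 is impossible because an orientation has no 2-cycles.

open import Defs
open import Data.Bool using (Bool; true; false; not)
open import Data.Empty using (⊥-elim)
open import Data.Fin as Fin using (Fin; zero; suc; toℕ; fromℕ)
open import Data.Fin.Properties using (toℕ-fromℕ<; toℕ-fromℕ; toℕ-injective; toℕ<n)
open import Data.Nat
open import Data.Nat.Coprimality as Coprimality using (Coprime; coprime-Bézout; coprime-divisor; gcd≡1⇒coprime)
open import Data.Nat.DivMod
open import Data.Nat.Divisibility
open import Data.Nat.GCD using (gcd; module Bézout)
open import Data.Nat.Primality using (Prime; prime⇒irreducible; euclidsLemma; prime[2]; ¬prime[1])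
open import Data.Nat.Properties
open import Data.Nat.Tactic.RingSolver using (solve-∀)
open import Data.Product
open import Data.Sum as Sum using (_⊎_; inj₁; inj₂)
open import Function using (_∘_)
open import Relation.Binary.Definitions using (tri<; tri≈; tri>)
open import Relation.Binary.PropositionalEquality
open import Relation.Nullary using (¬_; ¬?; contradiction; Dec; yes; no; does)
open import Relation.Nullary.Decidable using (_×-dec_; _⊎-dec_; dec-true; dec-false)

-- Congruences

module _ {m : ℕ} .{{_ : NonZero m}} where

  ≡[]⇒%≡ : ∀ {a b} → a ≡[ m ] b → a % m ≡ b % m
  ≡[]⇒%≡ {a} {b} (s , t , e) = begin
    a % m           ≡⟨ [m+kn]%n≡m%n a s m ⟨
    (a + s * m) % m ≡⟨ cong (_% m) e ⟩
    (b + t * m) % m ≡⟨ [m+kn]%n≡m%n b t m ⟩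
    b % m           ∎
    where open ≡-Reasoning

  %≡⇒≡[] : ∀ {a b} → a % m ≡ b % m → a ≡[ m ] b
  %≡⇒≡[] {a} {b} e = b / m , a / m , (begin
    a + b / m * m                 ≡⟨ cong (_+ b / m * m) (m≡m%n+[m/n]*n a m) ⟩
    a % m + a / m * m + b / m * m ≡⟨ exchange (a % m) (a / m * m) (b / m * m) ⟩
    a % m + b / m * m + a / m * m ≡⟨ cong (λ r → r + b / m * m + a / m * m) e ⟩
    b % m + b / m * m + a / m * m ≡⟨ cong (_+ a / m * m) (m≡m%n+[m/n]*n b m) ⟨
    b + a / m * m                 ∎)
    where
    open ≡-Reasoning
    exchange : ∀ r x y → r + x + y ≡ r + y + x
    exchange = solve-∀

  %-cong-+ : ∀ {a b c d} → a % m ≡ b % m → c % m ≡ d % m → (a + c) % m ≡ (b + d) % m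
  %-cong-+ {a} {b} {c} {d} a≡b c≡d = begin
    (a + c) % m         ≡⟨ %-distribˡ-+ a c m ⟩
    (a % m + c % m) % m ≡⟨ cong₂ (λ x y → (x + y) % m) a≡b c≡d ⟩
    (b % m + d % m) % m ≡⟨ %-distribˡ-+ b d m ⟨
    (b + d) % m         ∎
    where open ≡-Reasoning

  %-cong-* : ∀ {a b c d} → a % m ≡ b % m → c % m ≡ d % m → (a * c) % m ≡ (b * d) % m
  %-cong-* {a} {b} {c} {d} a≡b c≡d = begin
    (a * c) % m           ≡⟨ %-distribˡ-* a c m ⟩
    (a % m * (c % m)) % m ≡⟨ cong₂ (λ x y → (x * y) % m) a≡b c≡d ⟩
    (b % m * (d % m)) % m ≡⟨ %-distribˡ-* b d m ⟨
    (b * d) % m           ∎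
    where open ≡-Reasoning

  %-cancelˡ-+ : ∀ c {a b} → (c + a) % m ≡ (c + b) % m → a % m ≡ b % m
  %-cancelˡ-+ c {a} {b} e with %≡⇒≡[] e
  ... | s , t , eq = ≡[]⇒%≡ (s , t , +-cancelˡ-≡ c (a + s * m) (b + t * m)
    (trans (sym (+-assoc c a (s * m))) (trans eq (+-assoc c b (t * m)))))

  ∣-resp-% : ∀ {a b d} → d ∣ m → a % m ≡ b % m → d ∣ a → d ∣ b
  ∣-resp-% d∣m a≡b d∣a = ∣n∣m%n⇒∣m d∣m (subst (_ ∣_) a≡b (%-presˡ-∣ d∣a d∣m))

  select-first : ∀ {a b e f} → e % m ≡ 1 % m → m ∣ f → (a * e + b * f) % m ≡ a % m
  select-first {a} {b} {e} {f} e≡1 m∣f = begin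
    (a * e + b * f) % m ≡⟨ %-cong-+ (%-cong-* {a} refl e≡1) (%-cong-* {b} refl f≡0) ⟩
    (a * 1 + b * 0) % m ≡⟨ cong (_% m) (trans (cong₂ _+_ (*-identityʳ a) (*-zeroʳ b)) (+-identityʳ a)) ⟩
    a % m               ∎
    where
    open ≡-Reasoning
    f≡0 : f % m ≡ 0 % m
    f≡0 = trans (n∣m⇒m%n≡0 f m m∣f) (sym (n∣m⇒m%n≡0 0 m (m ∣0)))

inverse : ∀ {y m} .{{_ : NonZero m}} → Coprime y m → ∃ λ y⁻¹ → (y * y⁻¹) % m ≡ 1 % m
inverse {y} {m@(suc m-1)} y⊥m with coprime-Bézout y⊥m
... | Bézout.+- x t eq = x , ≡[]⇒%≡ (0 , t , trans (+-identityʳ (y * x)) (trans (*-comm y x) (sym eq)))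
... | Bézout.-+ x t eq = m-1 * x , ≡[]⇒%≡ (1 , m-1 * t , (begin
  y * (m-1 * x) + 1 * m ≡⟨ lhs y x m-1 ⟩
  m-1 * (1 + x * y) + 1 ≡⟨ cong (λ r → m-1 * r + 1) eq ⟩
  m-1 * (t * m) + 1     ≡⟨ rhs m-1 t ⟩
  1 + m-1 * t * m       ∎))
  where
  open ≡-Reasoning
  lhs : ∀ y x m-1 → y * (m-1 * x) + 1 * suc m-1 ≡ m-1 * (1 + x * y) + 1
  lhs = solve-∀
  rhs : ∀ m-1 t → m-1 * (t * suc m-1) + 1 ≡ 1 + m-1 * t * suc m-1
  rhs = solve-∀

crt : ∀ {m n} .{{_ : NonZero m}} .{{_ : NonZero n}} → Coprime m n →
      ∀ a b → ∃ λ c → c % m ≡ a % m × c % n ≡ b % n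
crt {m} {n} m⊥n a b =
  a * (n * n⁻¹) + b * (m * m⁻¹) ,
  select-first {b = b} nn⁻¹≡1 (m∣m*n m⁻¹) ,
  trans (cong (_% n) (+-comm (a * (n * n⁻¹)) _)) (select-first {b = a} mm⁻¹≡1 (m∣m*n n⁻¹))
  where
  m⁻¹ = proj₁ (inverse m⊥n)
  mm⁻¹≡1 = proj₂ (inverse m⊥n)
  n⁻¹ = proj₁ (inverse (Coprimality.sym m⊥n))
  nn⁻¹≡1 = proj₂ (inverse (Coprimality.sym m⊥n))

coprime-* : ∀ {m a b} → Coprime m a → Coprime m b → Coprime m (a * b)
coprime-* m⊥a m⊥b (d∣m , d∣ab) = m⊥b (d∣m , coprime-divisor (λ (c∣d , c∣a) → m⊥a (∣-trans c∣d d∣m , c∣a)) d∣ab)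

coprime-^ : ∀ {m a} → Coprime m a → ∀ e → Coprime m (a ^ e)
coprime-^ m⊥a zero    (_ , d∣1) = ∣1⇒≡1 d∣1
coprime-^ m⊥a (suc e) = coprime-* m⊥a (coprime-^ m⊥a e)

∤⇒coprime : ∀ {p y} → Prime p → ¬ p ∣ y → Coprime y p
∤⇒coprime p-prime p∤y (d∣y , d∣p) with prime⇒irreducible p-prime d∣p
... | inj₁ d≡1 = d≡1
... | inj₂ refl = ⊥-elim (p∤y d∣y)

odd⇒≡1+2k : ∀ m → ¬ 2 ∣ m → ∃ λ k → m ≡ suc (k + k)
odd⇒≡1+2k zero          2∤0   = ⊥-elim (2∤0 (2 ∣0))
odd⇒≡1+2k (suc zero)    _     = 0 , refl
odd⇒≡1+2k (suc (suc m)) 2∤2+m with odd⇒≡1+2k m (2∤2+m ∘ ∣m∣n⇒∣m+n ∣-refl)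
... | k , refl = suc k , cong (2 +_) (sym (+-suc k k))

2∤odd-prime^ : ∀ {p} → Prime p → p ≢ 2 → ∀ e → ¬ 2 ∣ p ^ e
2∤odd-prime^ p-prime p≢2 zero    2∣1 = contradiction (∣1⇒≡1 2∣1) λ ()
2∤odd-prime^ p-prime p≢2 (suc e) 2∣p^1+e with euclidsLemma _ _ prime[2] 2∣p^1+e
... | inj₂ 2∣p^e = 2∤odd-prime^ p-prime p≢2 e 2∣p^e
... | inj₁ 2∣p with prime⇒irreducible p-prime 2∣p
...   | inj₂ 2≡p = p≢2 (sym 2≡p)

-- Power graphs of cyclic groups

PowGraph-sym : ∀ {V} (pow : ℕ → V → V → Set) {x y} → Adj (PowGraph pow) x y → Adj (PowGraph pow) y x
PowGraph-sym _ (x≢y , comparable) = ≢-sym x≢y , Sum.swap comparable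

_∈⟨_⟩ : ∀ {m} → Fin m → Fin m → Set
_∈⟨_⟩ {m} x y = ∃ λ c → IsPowZ m c x y

Generator : ∀ {m} → Fin m → Set
Generator y = ∀ x → x ∈⟨ y ⟩

∈⟨⟩-refl : ∀ {m} .{{_ : NonZero m}} (x : Fin m) → x ∈⟨ x ⟩
∈⟨⟩-refl x = 1 , %≡⇒≡[] (cong (_% _) (sym (*-identityˡ (toℕ x))))

zero∈⟨⟩ : ∀ {m} (y : Fin (suc m)) → zero ∈⟨ y ⟩
zero∈⟨⟩ y = 0 , 0 , 0 , refl

invertible⇒generator : ∀ {m y⁻¹} .{{_ : NonZero m}} {y : Fin m} → (toℕ y * y⁻¹) % m ≡ 1 % m → Generator y
invertible⇒generator {m} {y⁻¹} {y} yy⁻¹≡1 x = toℕ x * y⁻¹ , %≡⇒≡[] (begin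
  toℕ x % m                   ≡⟨ cong (_% m) (*-identityʳ (toℕ x)) ⟨
  (toℕ x * 1) % m             ≡⟨ %-cong-* {a = toℕ x} refl yy⁻¹≡1 ⟨
  (toℕ x * (toℕ y * y⁻¹)) % m ≡⟨ cong (_% m) (rearrange (toℕ x) (toℕ y) y⁻¹) ⟩
  (toℕ x * y⁻¹ * toℕ y) % m   ∎)
  where
  open ≡-Reasoning
  rearrange : ∀ x y z → x * (y * z) ≡ x * z * y
  rearrange = solve-∀

×-∈⟨⟩ : ∀ {m n} .{{_ : NonZero m}} .{{_ : NonZero n}} → Coprime m n →
        ∀ {x₁ y₁ : Fin m} {x₂ y₂ : Fin n} → x₁ ∈⟨ y₁ ⟩ → x₂ ∈⟨ y₂ ⟩ → ∃ λ c → IsPowZ× m n c (x₁ , x₂) (y₁ , y₂)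
×-∈⟨⟩ {m} {n} m⊥n {y₁ = y₁} {y₂ = y₂} (c₁ , x₁≡c₁y₁) (c₂ , x₂≡c₂y₂) with crt m⊥n c₁ c₂
... | c , c≡c₁ , c≡c₂ =
  c , %≡⇒≡[] (trans (≡[]⇒%≡ x₁≡c₁y₁) (%-cong-* {m} (sym c≡c₁) (refl {x = toℕ y₁ % m})))
    , %≡⇒≡[] (trans (≡[]⇒%≡ x₂≡c₂y₂) (%-cong-* {n} (sym c≡c₂) (refl {x = toℕ y₂ % n})))

-- Orientations of diameter two

data Within₂ {V : Set} (D : Digraph V) : V → V → Set where
  stay : ∀ {a} → Within₂ D a a
  hop  : ∀ {a b} → D a b → Within₂ D a b
  hop₂ : ∀ {a w b} → D a w → D w b → Within₂ D a b

module _ {V : Set} {D : Digraph V} where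

  DistLE⇒Within₂ : ∀ {a b} → DistLE D a b 2 → Within₂ D a b
  DistLE⇒Within₂ (_ , _ , here) = stay
  DistLE⇒Within₂ (_ , _ , step d here) = hop d
  DistLE⇒Within₂ (_ , _ , step d (step d′ here)) = hop₂ d d′
  DistLE⇒Within₂ (_ , s≤s (s≤s ()) , step _ (step _ (step _ _)))

  Within₂⇒DistLE : ∀ {a b} → Within₂ D a b → DistLE D a b 2
  Within₂⇒DistLE stay        = 0 , z≤n , here
  Within₂⇒DistLE (hop d)     = 1 , s≤s z≤n , step d here
  Within₂⇒DistLE (hop₂ d d′) = 2 , ≤-refl , step d (step d′ here)

  module _ {X : Graph V} (D-orientation : IsOrientation X D) where
    open IsOrientation D-orientation

    2≤diam : ∀ {u v} → u ≢ v → ∀ m → DiamLE D m → 2 ≤ m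
    2≤diam {u} {v} u≢v zero diam with diam u v
    ... | zero , _ , here = ⊥-elim (u≢v refl)
    2≤diam {u} {v} u≢v (suc zero) diam with diam u v | diam v u
    ... | zero , _ , here | _ = ⊥-elim (u≢v refl)
    ... | suc zero , _ , step d here | suc zero , _ , step d′ here = ⊥-elim (not-both u v d d′)
    ... | suc zero , _ , _ | zero , _ , here = ⊥-elim (u≢v refl)
    ... | suc (suc _) , s≤s () , _ | _
    ... | suc zero , _ , _ | suc (suc _) , s≤s () , _
    2≤diam _ (suc (suc m)) _ = s≤s (s≤s z≤n)

3≤n : ∀ {n} → 1 ≤ n → OrientedDiameterIs (PowZ n) 2 → ∃ λ n″ → n ≡ 3 + n″
3≤n {suc (suc (suc n″))} _ _ = n″ , refl
3≤n {1} _ ((D , D-orientation , _) , minimal) =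
  contradiction (minimal D D-orientation 0 λ { zero zero → 0 , z≤n , here }) λ ()
3≤n {2} _ ((D , D-orientation , diam) , _) =
  ⊥-elim (not-both zero (suc zero) (arc-between (λ ()) (DistLE⇒Within₂ (diam _ _)))
                                   (arc-between (λ ()) (DistLE⇒Within₂ (diam _ _))))
  where
  open IsOrientation D-orientation
  loopless : ∀ {a} → ¬ D a a
  loopless {a} d = proj₁ (arc⇒adj a a d) refl
  arc-between : ∀ {a b : Fin 2} → a ≢ b → Within₂ D a b → D a b
  arc-between a≢b stay = ⊥-elim (a≢b refl)
  arc-between _ (hop d) = d
  arc-between {zero}     {zero}     a≢b _ = ⊥-elim (a≢b refl)
  arc-between {suc zero} {suc zero} a≢b _ = ⊥-elim (a≢b refl)
  arc-between {zero}     {suc zero} _ (hop₂ {w = suc zero} d _)    = d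
  arc-between {zero}     {suc zero} _ (hop₂ {w = zero}     loop _) = ⊥-elim (loopless loop)
  arc-between {suc zero} {zero}     _ (hop₂ {w = zero}     d _)    = d
  arc-between {suc zero} {zero}     _ (hop₂ {w = suc zero} loop _) = ⊥-elim (loopless loop)

-- The rotational tournament on ℤ_q

-- q is a parameter rather than the term suc (k + k): for a concrete divisor x % q unfolds, and the
-- dividend x could then no longer be inferred from the type of a congruence.
module RotationalTournament {q : ℕ} .{{_ : NonZero q}} (k : ℕ) (q≡1+2k : q ≡ suc (k + k)) where

  2k<q : k + k < q
  2k<q = ≤-reflexive (sym q≡1+2k)

  infix 4 _⟶_
  record _⟶_ (x y : ℕ) : Set where
    constructor arc
    field
      offset   : ℕ
      1≤offset : 1 ≤ offset
      offset≤k : offset ≤ k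
      lands    : (x + offset) % q ≡ y % q

  wrap : ∀ {x y d e} → (x + d) % q ≡ y % q → d + e ≡ q → (y + e) % q ≡ x % q
  wrap {x} {y} {d} {e} x+d≡y d+e≡q = begin
    (y + e) % q     ≡⟨ %-cong-+ (sym x+d≡y) (refl {x = e % q}) ⟩
    (x + d + e) % q ≡⟨ cong (_% q) (trans (+-assoc x d e) (cong (x +_) d+e≡q)) ⟩
    (x + q) % q     ≡⟨ [m+n]%n≡m%n x q ⟩
    x % q           ∎
    where open ≡-Reasoning

  no-short-return : ∀ {x r} → 1 ≤ r → r < q → (x + r) % q ≢ x % q
  no-short-return {x} {r} 1≤r r<q x+r≡x = contradiction r≡0 (≢-sym (<⇒≢ 1≤r))
    where
    r≡0 : r ≡ 0
    r≡0 = begin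
      r           ≡⟨ m<n⇒m%n≡m r<q ⟨
      r % q       ≡⟨ %-cancelˡ-+ x (trans x+r≡x (cong (_% q) (sym (+-identityʳ x)))) ⟩
      0 % q       ≡⟨ n∣m⇒m%n≡0 0 q (q ∣0) ⟩
      0           ∎
      where open ≡-Reasoning

  ⟶-irrefl : ∀ {x} → ¬ x ⟶ x
  ⟶-irrefl (arc d 1≤d d≤k x+d≡x) = no-short-return 1≤d (≤-<-trans (≤-trans d≤k (m≤m+n k k)) 2k<q) x+d≡x

  ⟶-asym : ∀ {x y} → x ⟶ y → ¬ y ⟶ x
  ⟶-asym {x} {y} (arc d 1≤d d≤k x+d≡y) (arc e _ e≤k y+e≡x) =
    no-short-return (≤-trans 1≤d (m≤m+n d e)) (≤-<-trans (+-mono-≤ d≤k e≤k) 2k<q) (begin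
      (x + (d + e)) % q ≡⟨ cong (_% q) (+-assoc x d e) ⟨
      (x + d + e) % q   ≡⟨ %-cong-+ x+d≡y (refl {x = e % q}) ⟩
      (y + e) % q       ≡⟨ y+e≡x ⟩
      x % q             ∎)
    where open ≡-Reasoning

  ⟶-respˡ : ∀ {x x′ y} → x % q ≡ x′ % q → x ⟶ y → x′ ⟶ y
  ⟶-respˡ x≡x′ (arc d 1≤d d≤k x+d≡y) = arc d 1≤d d≤k (trans (%-cong-+ (sym x≡x′) refl) x+d≡y)

  ⟶-respʳ : ∀ {x y y′} → y % q ≡ y′ % q → x ⟶ y → x ⟶ y′
  ⟶-respʳ y≡y′ (arc d 1≤d d≤k x+d≡y) = arc d 1≤d d≤k (trans x+d≡y y≡y′)

  ⟶-total-< : ∀ {x y} → x < y → y < q → x ⟶ y ⊎ y ⟶ x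
  ⟶-total-< {x} {y} x<y y<q = split (y ∸ x ≤? k)
    where
    x+d≡y : (x + (y ∸ x)) % q ≡ y % q
    x+d≡y = cong (_% q) (m+[n∸m]≡n (<⇒≤ x<y))
    d<q : y ∸ x < q
    d<q = ≤-<-trans (m∸n≤m y x) y<q
    q-1-k≡k : q ∸ suc k ≡ k
    q-1-k≡k = trans (cong (_∸ suc k) q≡1+2k) (m+n∸m≡n k k)
    split : Dec (y ∸ x ≤ k) → x ⟶ y ⊎ y ⟶ x
    split (yes d≤k) = inj₁ (arc (y ∸ x) (m<n⇒0<n∸m x<y) d≤k x+d≡y)
    split (no d≰k)  = inj₂ (arc (q ∸ (y ∸ x)) (m<n⇒0<n∸m d<q)
      (≤-trans (∸-monoʳ-≤ q (≰⇒> d≰k)) (≤-reflexive q-1-k≡k))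
      (wrap x+d≡y (m+[n∸m]≡n (<⇒≤ d<q))))

  ⟶-total : ∀ {x y} → x < q → y < q → x ≢ y → x ⟶ y ⊎ y ⟶ x
  ⟶-total {x} {y} x<q y<q x≢y with <-cmp x y
  ... | tri< x<y _ _ = ⟶-total-< x<y y<q
  ... | tri≈ _ x≡y _ = contradiction x≡y x≢y
  ... | tri> _ _ y<x = Sum.swap (⟶-total-< y<x x<q)

  triangle : ∀ {x y d s e} → (x + d) % q ≡ y % q → d + (s + e) ≡ q →
             1 ≤ s → s ≤ k → 1 ≤ e → e ≤ k → y ⟶ y + s × y + s ⟶ x
  triangle {x} {y} {d} {s} {e} x+d≡y d+s+e≡q 1≤s s≤k 1≤e e≤k =
    arc s 1≤s s≤k refl , arc e 1≤e e≤k (trans (cong (_% q) (+-assoc y s e)) (wrap x+d≡y d+s+e≡q))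

  triangle-by-k : ∀ {x y d j} → (x + d) % q ≡ y % q → 1 ≤ d → d + j ≡ k → y ⟶ y + k × y + k ⟶ x
  triangle-by-k {x} {y} {d} {j} x+d≡y 1≤d d+j≡k =
    triangle x+d≡y d+k+e≡q (subst (1 ≤_) d+j≡k (≤-trans 1≤d (m≤m+n d j))) ≤-refl
             (s≤s z≤n) (subst (suc j ≤_) d+j≡k (+-monoˡ-≤ j 1≤d))
    where
    identity : ∀ d k j → d + (k + suc j) ≡ suc (k + (d + j))
    identity = solve-∀
    d+k+e≡q : d + (k + suc j) ≡ q
    d+k+e≡q = trans (identity d k j) (trans (cong (λ t → suc (k + t)) d+j≡k) (sym q≡1+2k))

  triangle-by-k-1 : ∀ {x y d j} → (x + (2 + d)) % q ≡ y % q → 2 + d + j ≡ k →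
                    y ⟶ y + suc (d + j) × y + suc (d + j) ⟶ x
  triangle-by-k-1 {x} {y} {d} {j} x+d≡y d+j≡k =
    triangle x+d≡y d+s+e≡q (s≤s z≤n) (≤-trans (n≤1+n _) (≤-reflexive d+j≡k))
             (s≤s z≤n) (≤-trans (s≤s (s≤s (m≤n+m j d))) (≤-reflexive d+j≡k))
    where
    identity : ∀ d j → 2 + d + (suc (d + j) + suc (suc j)) ≡ suc ((2 + d + j) + (2 + d + j))
    identity = solve-∀
    d+s+e≡q : 2 + d + (suc (d + j) + suc (suc j)) ≡ q
    d+s+e≡q = trans (identity d j) (trans (cong (λ t → suc (t + t)) d+j≡k) (sym q≡1+2k))

  Apex : ℕ → ℕ → Set
  Apex x y = ∃ λ (c : Fin q) → y ⟶ toℕ c × toℕ c ⟶ x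

  reduce : ∀ {x y c} → y ⟶ c → c ⟶ x → Σ (Apex x y) λ (c′ , _) → toℕ c′ % q ≡ c % q
  reduce {c = c} y⟶c c⟶x = (c mod q , ⟶-respʳ (sym c′≡c) y⟶c , ⟶-respˡ (sym c′≡c) c⟶x) , c′≡c
    where
    c′≡c : toℕ (c mod q) % q ≡ c % q
    c′≡c = trans (cong (_% q) (toℕ-fromℕ< (m%n<n c q))) (m%n%n≡m%n c q)

  apex : ∀ {x y} → x ⟶ y → Apex x y
  apex (arc d 1≤d d≤k x+d≡y) =
    proj₁ (uncurry reduce (triangle-by-k x+d≡y 1≤d (proj₂ (m≤n⇒∃[o]m+o≡n d≤k))))

  module PrimeDivisor {p : ℕ} (p∣q : p ∣ q) (p∤1 : ¬ p ∣ 1) where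

    Critical : ℕ → Set
    Critical x = p ∣ x + suc k

    UnitApex : ℕ → ℕ → Set
    UnitApex x y = ∃ λ (c : Fin q) → y ⟶ toℕ c × toℕ c ⟶ x × ¬ p ∣ toℕ c

    reduce-unit : ∀ {x y c} → y ⟶ c × c ⟶ x → ¬ p ∣ c → UnitApex x y
    reduce-unit (y⟶c , c⟶x) p∤c with reduce y⟶c c⟶x
    ... | (c′ , y⟶c′ , c′⟶x) , c′≡c = c′ , y⟶c′ , c′⟶x , p∤c ∘ ∣-resp-% p∣q c′≡c

    -- The apex y + k works unless p ∣ y + k; then y + (k − 1) works unless the offset of x ⟶ y is 1.
    unit-apex : ∀ {x y} → x ⟶ y → UnitApex x y ⊎ ((x + 1) % q ≡ y % q × Critical x)
    unit-apex {x} {y} (arc d 1≤d d≤k x+d≡y) with m≤n⇒∃[o]m+o≡n d≤k | p ∣? y + k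
    ... | j , d+j≡k | no p∤y+k = inj₁ (reduce-unit (triangle-by-k x+d≡y 1≤d d+j≡k) p∤y+k)
    unit-apex {x} {y} (arc 1 _ _ x+1≡y) | _ | yes p∣y+k =
      inj₂ (x+1≡y , ∣-resp-% p∣q y+k≡x+1+k p∣y+k)
      where
      y+k≡x+1+k : (y + k) % q ≡ (x + suc k) % q
      y+k≡x+1+k = trans (%-cong-+ (sym x+1≡y) (refl {x = k % q})) (cong (_% q) (+-assoc x 1 k))
    unit-apex {x} {y} (arc (suc (suc d)) _ _ x+d≡y) | j , d+j≡k | yes p∣y+k =
      inj₁ (reduce-unit (triangle-by-k-1 x+d≡y d+j≡k) p∤c)
      where
      c+1≡y+k : y + suc (d + j) + 1 ≡ y + k
      c+1≡y+k = trans (+-assoc y _ 1) (cong (y +_) (trans (+-comm (suc (d + j)) 1) d+j≡k))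
      p∤c : ¬ p ∣ y + suc (d + j)
      p∤c p∣c = p∤1 (∣m+n∣m⇒∣n (subst (p ∣_) (sym c+1≡y+k) p∣y+k) p∣c)

    p∤k : ¬ p ∣ k
    p∤k p∣k = p∤1 (∣m+n∣m⇒∣n (subst (p ∣_) (trans q≡1+2k (+-comm 1 (k + k))) p∣q) (∣m∣n⇒∣m+n p∣k p∣k))

    critical-step : ∀ {x y} → (x + 1) % q ≡ y % q → Critical x → ¬ p ∣ x × ¬ p ∣ y × ¬ Critical y
    critical-step {x} {y} x+1≡y p∣x+1+k = p∤x , p∤y , ¬critical-y
      where
      p∤x : ¬ p ∣ x
      p∤x p∣x = p∤k (∣m+n∣m⇒∣n (subst (p ∣_) q≡1+2k p∣q) (∣m+n∣m⇒∣n p∣x+1+k p∣x))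
      p∤y : ¬ p ∣ y
      p∤y p∣y = p∤k (∣m+n∣m⇒∣n (subst (p ∣_) (sym (+-assoc x 1 k)) p∣x+1+k) (∣-resp-% p∣q (sym x+1≡y) p∣y))
      y+1+k≡x+1+k+1 : (y + suc k) % q ≡ (x + suc k + 1) % q
      y+1+k≡x+1+k+1 = trans (%-cong-+ (sym x+1≡y) (refl {x = suc k % q})) (cong (_% q) (identity x k))
        where
        identity : ∀ x k → x + 1 + suc k ≡ x + suc k + 1
        identity = solve-∀
      ¬critical-y : ¬ Critical y
      ¬critical-y p∣y+1+k = p∤1 (∣m+n∣m⇒∣n (∣-resp-% p∣q y+1+k≡x+1+k+1 p∣y+1+k) p∣x+1+k)

-- The orientation of Pow(ℤ_n × ℤ_q)

module Construction
  (n″ : ℕ) {D : Digraph (Fin (3 + n″))} (D-orientation : IsOrientation (PowZ (3 + n″)) D) (D-diam : DiamLE D 2)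
  {q : ℕ} .{{_ : NonZero q}} (k : ℕ) (q≡1+2k : q ≡ suc (k + k))
  {p : ℕ} (p∣q : p ∣ q) (p∤1 : ¬ p ∣ 1) (n⊥q : Coprime (3 + n″) q) (unit⊥q : ∀ {y} → ¬ p ∣ y → Coprime y q)
  where

  open RotationalTournament k q≡1+2k
  open PrimeDivisor p∣q p∤1
  open IsOrientation D-orientation renaming (arc⇒adj to D⇒adj; adj⇒arc to adj⇒D; not-both to D-not-both)

  n : ℕ
  n = 3 + n″

  V : Set
  V = Fin n × Fin q

  G : Graph V
  G = PowZ× n q

  within : ∀ a b → Within₂ D a b
  within a b = DistLE⇒Within₂ (D-diam a b)

  D-≢ : ∀ {a b} → D a b → a ≢ b
  D-≢ d = proj₁ (D⇒adj _ _ d)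

  out-neighbour : ∀ {a b} → a ≢ b → ∃ λ w → D a w
  out-neighbour {a} {b} a≢b with within a b
  ... | stay       = contradiction refl a≢b
  ... | hop d      = b , d
  ... | hop₂ d _   = _ , d

  in-neighbour : ∀ {a b} → a ≢ b → ∃ λ w → D w b
  in-neighbour {a} {b} a≢b with within a b
  ... | stay       = contradiction refl a≢b
  ... | hop d      = a , d
  ... | hop₂ _ d   = _ , d

  one last : Fin n
  one  = suc zero
  last = fromℕ (2 + n″)

  one-generator : Generator one
  one-generator = invertible⇒generator {y⁻¹ = 1} refl

  last-generator : Generator last
  last-generator = invertible⇒generator {y⁻¹ = 2 + n″} (≡[]⇒%≡ {a = toℕ last * (2 + n″)} {b = 1} (1 , 2 + n″ ,
    trans (cong (λ t → t * (2 + n″) + 1 * n) (toℕ-fromℕ (2 + n″))) (identity n″)))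
    where
    identity : ∀ m → (2 + m) * (2 + m) + 1 * (3 + m) ≡ 1 + (2 + m) * (3 + m)
    identity = solve-∀

  Unit : Fin q → Set
  Unit z = ¬ p ∣ toℕ z

  unit-generator : ∀ {z} → Unit z → Generator z
  unit-generator p∤z = invertible⇒generator (proj₂ (inverse (unit⊥q p∤z)))

  hub : Bool → Fin n
  hub true  = one
  hub false = last

  hub-generator : ∀ b → Generator (hub b)
  hub-generator true  = one-generator
  hub-generator false = last-generator

  hub≢hub-not : ∀ b → hub b ≢ hub (not b)
  hub≢hub-not true  ()
  hub≢hub-not false ()

  zero≢hub : ∀ b → zero ≢ hub b
  zero≢hub true  ()
  zero≢hub false ()

  critical? : ∀ (z : Fin q) → Dec (Critical (toℕ z))
  critical? z = p ∣? toℕ z + suc k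

  -- Over a critical z the special hub is 1, over its successor z + 1 it is n − 1 (see CriticalStep).
  specialHub otherHub : Fin q → Fin n
  specialHub z = hub (does (critical? z))
  otherHub   z = hub (not (does (critical? z)))

  Special : V → Set
  Special (h , z) = Unit z × h ≡ specialHub z

  special? : ∀ u → Dec (Special u)
  special? (h , z) = ¬? (p ∣? toℕ z) ×-dec (h Fin.≟ specialHub z)

  special-hub : ∀ {c} → Unit c → Special (specialHub c , c)
  special-hub p∤c = p∤c , refl

  ¬special-otherHub : ∀ {c} → ¬ Special (otherHub c , c)
  ¬special-otherHub {c} (_ , eq) = hub≢hub-not (does (critical? c)) (sym eq)

  ¬special-zero : ∀ {c} → ¬ Special (zero , c)
  ¬special-zero {c} (_ , eq) = zero≢hub (does (critical? c)) eq

  Universal : V → Set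
  Universal (g , c) = Generator g × Generator c

  special⇒universal : ∀ {u} → Special u → Universal u
  special⇒universal {_ , z} (p∤z , refl) = hub-generator (does (critical? z)) , unit-generator p∤z

  otherHub-universal : ∀ {c} → Unit c → Universal (otherHub c , c)
  otherHub-universal {c} p∤c = hub-generator (not (does (critical? c))) , unit-generator p∤c

  adj : ∀ {u v} → u ≢ v →
        (proj₁ u ∈⟨ proj₁ v ⟩ × proj₂ u ∈⟨ proj₂ v ⟩) ⊎ (proj₁ v ∈⟨ proj₁ u ⟩ × proj₂ v ∈⟨ proj₂ u ⟩) →
        Adj G u v
  adj u≢v comparable = u≢v , Sum.map (uncurry (×-∈⟨⟩ n⊥q)) (uncurry (×-∈⟨⟩ n⊥q)) comparable

  G-sym : ∀ {u v} → Adj G u v → Adj G v u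
  G-sym = PowGraph-sym (IsPowZ× n q)

  adj-universal : ∀ {v w} → Universal w → v ≢ w → Adj G v w
  adj-universal {v} (gen₁ , gen₂) v≢w = adj v≢w (inj₁ (gen₁ (proj₁ v) , gen₂ (proj₂ v)))

  adj-layer : ∀ {a b z} → Adj (PowZ n) a b → Adj G (a , z) (b , z)
  adj-layer {z = z} (a≢b , comparable) =
    adj (a≢b ∘ cong proj₁) (Sum.map (_, ∈⟨⟩-refl z) (_, ∈⟨⟩-refl z) comparable)

  layer-adj : ∀ {a b z} → Adj G (a , z) (b , z) → Adj (PowZ n) a b
  layer-adj {z = z} (u≢v , comparable) = u≢v ∘ cong (_, z) , Sum.map (map₂ proj₁) (map₂ proj₁) comparable

  adj-units : ∀ {a b z w} → Unit z → Unit w → a ≡ b ⊎ Adj (PowZ n) a b → (a , z) ≢ (b , w) →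
              Adj G (a , z) (b , w)
  adj-units {a} p∤z p∤w (inj₁ refl)             ne = adj ne (inj₁ (∈⟨⟩-refl a , unit-generator p∤w _))
  adj-units     p∤z p∤w (inj₂ (_ , inj₁ a∈⟨b⟩)) ne = adj ne (inj₁ (a∈⟨b⟩ , unit-generator p∤w _))
  adj-units     p∤z p∤w (inj₂ (_ , inj₂ b∈⟨a⟩)) ne = adj ne (inj₂ (b∈⟨a⟩ , unit-generator p∤z _))

  adj-zero : ∀ {c h z} → Unit z → (zero , c) ≢ (h , z) → Adj G (zero , c) (h , z)
  adj-zero {h = h} p∤z ne = adj ne (inj₁ (zero∈⟨⟩ h , unit-generator p∤z _))

  lvl : V → ℕ
  lvl (_ , z) = toℕ z

  data Arc : V → V → Set where
    layer    : ∀ {a b z} → D a b → Arc (a , z) (b , z)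
    forward  : ∀ {u v} → lvl u ⟶ lvl v → ¬ Special u → ¬ Special v → Arc u v
    reversed : ∀ {u v} → lvl v ⟶ lvl u → Special u ⊎ Special v → Arc u v

  O : Digraph V
  O u v = Adj G u v × Arc u v

  arc⇒≢ : ∀ {u v} → Arc u v → u ≢ v
  arc⇒≢ (layer d)      refl = D-≢ d refl
  arc⇒≢ (forward t _ _) refl = ⟶-irrefl t
  arc⇒≢ (reversed t _)  refl = ⟶-irrefl t

  arc-asym : ∀ {u v} → Arc u v → ¬ Arc v u
  arc-asym (layer d)          (layer d′)         = D-not-both _ _ d d′
  arc-asym (layer _)          (forward t _ _)    = ⟶-irrefl t
  arc-asym (layer _)          (reversed t _)     = ⟶-irrefl t
  arc-asym (forward t _ _)    (layer _)          = ⟶-irrefl t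
  arc-asym (forward t _ _)    (forward t′ _ _)   = ⟶-asym t t′
  arc-asym (forward _ ¬su ¬sv) (reversed _ s)    = Sum.[ ¬sv , ¬su ] s
  arc-asym (reversed t _)     (layer _)          = ⟶-irrefl t
  arc-asym (reversed _ s)     (forward _ ¬sv ¬su) = Sum.[ ¬su , ¬sv ] s
  arc-asym (reversed t _)     (reversed t′ _)    = ⟶-asym t t′

  orient : ∀ u v → Adj G u v → Arc u v ⊎ Arc v u
  orient u@(a , z) v@(b , z′) uv with z Fin.≟ z′
  ... | yes refl = Sum.map layer layer (adj⇒D a b (layer-adj uv))
  ... | no z≢z′ with ⟶-total (toℕ<n z) (toℕ<n z′) (z≢z′ ∘ toℕ-injective) | special? u ⊎-dec special? v
  ...   | inj₁ t | no ¬s = inj₁ (forward t (¬s ∘ inj₁) (¬s ∘ inj₂))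
  ...   | inj₁ t | yes s = inj₂ (reversed t (Sum.swap s))
  ...   | inj₂ t | no ¬s = inj₂ (forward t (¬s ∘ inj₂) (¬s ∘ inj₁))
  ...   | inj₂ t | yes s = inj₁ (reversed t s)

  O-orientation : IsOrientation G O
  O-orientation = record
    { arc⇒adj  = λ _ _ → proj₁
    ; adj⇒arc  = λ u v uv → Sum.map (uv ,_) (G-sym uv ,_) (orient u v uv)
    ; not-both = λ _ _ (_ , a) (_ , a′) → arc-asym a a′
    }

  Reach : V → V → Set
  Reach = Within₂ O

  layer-arc : ∀ {a b z} → D a b → O (a , z) (b , z)
  layer-arc d = adj-layer (D⇒adj _ _ d) , layer d

  lift : ∀ {a b z} → Within₂ D a b → Reach (a , z) (b , z)
  lift stay        = stay
  lift (hop d)     = hop (layer-arc d)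
  lift (hop₂ d d′) = hop₂ (layer-arc d) (layer-arc d′)

  special-arc : ∀ {u v} → Special u ⊎ Special v → Arc u v → O u v
  special-arc (inj₁ su) a = G-sym (adj-universal (special⇒universal su) (≢-sym (arc⇒≢ a))) , a
  special-arc (inj₂ sv) a = adj-universal (special⇒universal sv) (arc⇒≢ a) , a

  via-universal : ∀ {u w v} → Universal w → Arc u w → Arc w v → Reach u v
  via-universal uw a b =
    hop₂ (adj-universal uw (arc⇒≢ a) , a) (G-sym (adj-universal uw (≢-sym (arc⇒≢ b))) , b)

  via-zero : ∀ {u v c} → Unit (proj₂ u) → Unit (proj₂ v) → Arc u (zero , c) → Arc (zero , c) v → Reach u v
  via-zero p∤u p∤v a b =
    hop₂ (G-sym (adj-zero p∤u (≢-sym (arc⇒≢ a))) , a) (adj-zero p∤v (arc⇒≢ b) , b)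

  module CriticalStep {z z′ : Fin q} (z⟶z′ : toℕ z ⟶ toℕ z′) (z+1≡z′ : (toℕ z + 1) % q ≡ toℕ z′ % q)
                      (critical : Critical (toℕ z)) where

    p∤z : Unit z
    p∤z = proj₁ (critical-step z+1≡z′ critical)

    p∤z′ : Unit z′
    p∤z′ = proj₁ (proj₂ (critical-step z+1≡z′ critical))

    specialHub≡one : specialHub z ≡ one
    specialHub≡one = cong hub (dec-true (critical? z) critical)

    specialHub′≡last : specialHub z′ ≡ last
    specialHub′≡last = cong hub (dec-false (critical? z′) (proj₂ (proj₂ (critical-step z+1≡z′ critical))))

    cross : ∀ {a b} → a ≢ one → b ≢ last → a ≡ b ⊎ Adj (PowZ n) a b → O (a , z) (b , z′)
    cross a≢one b≢last ab = adj-units p∤z p∤z′ ab (arc⇒≢ z→z′) , z→z′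
      where
      z→z′ = forward z⟶z′ (λ (_ , a≡hub) → a≢one (trans a≡hub specialHub≡one))
                         (λ (_ , b≡hub) → b≢last (trans b≡hub specialHub′≡last))

    layer-then-cross : ∀ {h w h′} → D h w → w ≢ one → h′ ≢ last → w ≡ h′ ⊎ Adj (PowZ n) w h′ →
                       Reach (h , z) (h′ , z′)
    layer-then-cross d w≢one h′≢last wh′ = hop₂ (layer-arc d) (cross w≢one h′≢last wh′)

    cross-then-layer : ∀ {h w h′} → h ≢ one → w ≢ last → h ≡ w ⊎ Adj (PowZ n) h w → D w h′ →
                       Reach (h , z) (h′ , z′)
    cross-then-layer h≢one w≢last hw d = hop₂ (cross h≢one w≢last hw) (layer-arc d)

    adj-one : ∀ {a} → a ≢ one → Adj (PowZ n) a one
    adj-one a≢one = a≢one , inj₁ (one-generator _)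

    one≢last : one ≢ last
    one≢last ()

    from-other : ∀ {h h′} → h ≢ one → h′ ≢ last → Within₂ D h h′ → Reach (h , z) (h′ , z′)
    from-other h≢one h′≢last stay    = hop (cross h≢one h′≢last (inj₁ refl))
    from-other h≢one h′≢last (hop d) = hop (cross h≢one h′≢last (inj₂ (D⇒adj _ _ d)))
    from-other h≢one h′≢last (hop₂ {w = w} d d′) with w Fin.≟ one
    ... | yes refl  = cross-then-layer h≢one one≢last (inj₂ (adj-one h≢one)) d′
    ... | no w≢one = layer-then-cross d w≢one h′≢last (inj₂ (D⇒adj _ _ d′))

    from-one : ∀ {h′} → h′ ≢ last → Within₂ D one h′ → Reach (one , z) (h′ , z′)
    from-one _ stay with out-neighbour {b = zero} (λ ())
    ... | _ , d = layer-then-cross d (≢-sym (D-≢ d)) one≢last (inj₂ (adj-one (≢-sym (D-≢ d))))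
    from-one h′≢last (hop d)     = layer-then-cross d (≢-sym (D-≢ d)) h′≢last (inj₁ refl)
    from-one h′≢last (hop₂ d d′) = layer-then-cross d (≢-sym (D-≢ d)) h′≢last (inj₂ (D⇒adj _ _ d′))

    to-last : ∀ {h} → h ≢ one → Within₂ D h last → Reach (h , z) (last , z′)
    to-last _ stay with in-neighbour {a = zero} (λ ())
    ... | _ , d = cross-then-layer (≢-sym one≢last) (D-≢ d) (inj₂ (PowGraph-sym (IsPowZ n) (D⇒adj _ _ d))) d
    to-last h≢one (hop d)     = cross-then-layer h≢one (D-≢ d) (inj₁ refl) d
    to-last h≢one (hop₂ d d′) = cross-then-layer h≢one (D-≢ d′) (inj₂ (D⇒adj _ _ d)) d′

    reach : ∀ h h′ → Reach (h , z) (h′ , z′)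
    reach h h′ with h Fin.≟ one | h′ Fin.≟ last | apex z⟶z′
    ... | yes refl | yes refl | _ , z′⟶c , c⟶z =
      via-zero p∤z p∤z′ (reversed c⟶z (inj₁ (p∤z , sym specialHub≡one)))
                        (reversed z′⟶c (inj₂ (p∤z′ , sym specialHub′≡last)))
    ... | yes refl | no h′≢last | _ = from-one h′≢last (within one h′)
    ... | no h≢one | yes refl   | _ = to-last h≢one (within h last)
    ... | no h≢one | no h′≢last | _ = from-other h≢one h′≢last (within h h′)

  reach-forward : ∀ u v → lvl u ⟶ lvl v → Reach u v
  reach-forward (h , z) (h′ , z′) t with unit-apex t
  ... | inj₁ (c , v⟶c , c⟶u , p∤c) =
    via-universal (special⇒universal (special-hub p∤c))
      (reversed c⟶u (inj₂ (special-hub p∤c))) (reversed v⟶c (inj₁ (special-hub p∤c)))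
  ... | inj₂ (z+1≡z′ , critical) = CriticalStep.reach t z+1≡z′ critical h h′

  reach-backward : ∀ u v → lvl v ⟶ lvl u → Reach u v
  reach-backward u v t with special? u ⊎-dec special? v
  ... | yes s = hop (special-arc s (reversed t s))
  ... | no ¬s with unit-apex t
  ...   | inj₁ (c , u⟶c , c⟶v , p∤c) =
    via-universal (otherHub-universal p∤c)
      (forward u⟶c (¬s ∘ inj₁) ¬special-otherHub) (forward c⟶v ¬special-otherHub (¬s ∘ inj₂))
  ...   | inj₂ (v+1≡u , critical) with critical-step v+1≡u critical | apex t
  ...     | p∤v , p∤u , _ | _ , u⟶c , c⟶v =
    via-zero p∤u p∤v (forward u⟶c (¬s ∘ inj₁) ¬special-zero) (forward c⟶v ¬special-zero (¬s ∘ inj₂))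

  reach : ∀ u v → Reach u v
  reach (h , z) (h′ , z′) with z Fin.≟ z′
  ... | yes refl = lift (within h h′)
  ... | no z≢z′ with ⟶-total (toℕ<n z) (toℕ<n z′) (z≢z′ ∘ toℕ-injective)
  ...   | inj₁ z⟶z′ = reach-forward _ _ z⟶z′
  ...   | inj₂ z′⟶z = reach-backward _ _ z′⟶z

  oriented-diameter : OrientedDiameterIs G 2
  oriented-diameter =
    (O , O-orientation , λ u v → Within₂⇒DistLE (reach u v)) ,
    λ _ orientation → 2≤diam orientation {u = zero , 0 mod q} {v = one , 0 mod q} λ ()

mainTheorem11 : (n p : ℕ) → 1 ≤ n → OrientedDiameterIs (PowZ n) 2 → Prime p → ¬ (p ≡ 2) → gcd n p ≡ 1
    → (α : ℕ) → 1 ≤ α → OrientedDiameterIs (PowZ× n (p ^ α)) 2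
mainTheorem11 n p 1≤n od@((_ , D-orientation , D-diam) , _) p-prime p≢2 gcd≡1 (suc α) _
  with 3≤n 1≤n od | odd⇒≡1+2k (p ^ suc α) (2∤odd-prime^ p-prime p≢2 (suc α))
... | n″ , refl | k , q≡1+2k =
  Construction.oriented-diameter n″ D-orientation D-diam
    {{subst NonZero (sym q≡1+2k) _}} k q≡1+2k
    (m∣m*n (p ^ α)) p∤1 (coprime-^ {a = p} (gcd≡1⇒coprime gcd≡1) (suc α))
    (λ p∤y → coprime-^ {a = p} (∤⇒coprime p-prime p∤y) (suc α))
  where
  p∤1 : ¬ p ∣ 1
  p∤1 p∣1 = ¬prime[1] (subst Prime (∣1⇒≡1 p∣1) p-prime)
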